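{- Let $G$ be a simple connected bipartite graph that does not have the $\{0,1\}$-property. If $v$ is a vertex of degree $1$ and $v'$ is its unique neighbour, then every edge incident to $v'$ is a bridge of $G$.
   Context: $G$ has the $\{0,1\}$-property if there is $w:E(G)\to\{0,1\}$ such that any two adjacent vertices $x,y$ satisfy $\sum_{e\ni x}w(e)\neq\sum_{e\ni y}w(e)$. -}

module Defs where

open import Data.Nat using (ℕ; zero; suc; _+_)
open import Data.Bool using (Bool; true; false; _∧_; _∨_; not; T)
open import Data.Fin using (Fin; zero; suc; _≟_)
open import Relation.Nullary using (¬_; ⌊_⌋)
open import Relation.Binary.PropositionalEquality using (_≡_; _≢_)
open import Relation.Binary.Construct.Closure.ReflexiveTransitive using (Star)
open import Data.Product using (Σ; _×_; _,_)

record Graph : Set where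
  field
    n      : ℕ
    adj    : Fin n → Fin n → Bool
    sym    : ∀ x y → adj x y ≡ adj y x
    irrefl : ∀ x → adj x x ≡ false
open Graph public

sumFin : (m : ℕ) → (Fin m → ℕ) → ℕ
sumFin zero    f = 0
sumFin (suc m) f = f zero + sumFin m (λ i → f (suc i))

b2n : Bool → ℕ
b2n true  = 1
b2n false = 0

Adj : (G : Graph) → Fin (n G) → Fin (n G) → Set
Adj G x y = T (adj G x y)

degree : (G : Graph) → Fin (n G) → ℕ
degree G x = sumFin (n G) (λ y → b2n (adj G x y))

Connected : Graph → Set
Connected G = ∀ x y → Star (Adj G) x y

Bipartite : Graph → Set
Bipartite G = Σ (Fin (n G) → Bool) λ c → ∀ x y → Adj G x y → c x ≢ c y

-- An edge labelling with values in {0,1}: a symmetric function on vertex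
-- pairs (only its values on edges matter).
EdgeWeight : Graph → Set
EdgeWeight G = Σ (Fin (n G) → Fin (n G) → Bool) λ w → ∀ x y → w x y ≡ w y x

wdeg : (G : Graph) → EdgeWeight G → Fin (n G) → ℕ
wdeg G (w , _) x = sumFin (n G) (λ y → b2n (adj G x y ∧ w x y))

Has01Property : Graph → Set
Has01Property G = Σ (EdgeWeight G) λ w → ∀ x y → Adj G x y → wdeg G w x ≢ wdeg G w y

_∈₂_ : ∀ {m} → Fin m → Fin m × Fin m → Bool
x ∈₂ (a , b) = ⌊ x ≟ a ⌋ ∨ ⌊ x ≟ b ⌋

deleteEdge : (G : Graph) → Fin (n G) → Fin (n G) → Graph
deleteEdge G a b = record
  { n = n G
  ; adj = A
  ; sym = symP
  ; irrefl = irr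
  }
  where
  open import Relation.Binary.PropositionalEquality using (cong₂; refl)
  open import Data.Bool.Properties using (∧-comm)
  A : Fin (n G) → Fin (n G) → Bool
  A x y = adj G x y ∧ not ((x ∈₂ (a , b)) ∧ (y ∈₂ (a , b)))
  symP : ∀ x y → A x y ≡ A y x
  symP x y = cong₂ (λ p q → p ∧ not q) (Graph.sym G x y) (∧-comm (x ∈₂ (a , b)) (y ∈₂ (a , b)))
  irr : ∀ x → A x x ≡ false
  irr x rewrite Graph.irrefl G x = refl

IsBridge : (G : Graph) → Fin (n G) → Fin (n G) → Set
IsBridge G a b = Adj G a b × ¬ Connected (deleteEdge G a b)

module Submission where

-- Toggling every edge of a walk changes the parity of the weighted degree exactly at the two
-- ends of the walk, so in a connected graph the parities can be prescribed at will away from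
-- one vertex. Take a proper 2-colouring c with c v = 1 and prescribe the parities c away from
-- the pendant vertex v. If v then has odd weighted degree, the parities properly colour G.
-- Otherwise v has weighted degree 0 and every edge other than vv′ is separated by parity; if
-- v′u lies on a cycle, toggling that cycle keeps all parities and lets us assume w(v′u) = 1,
-- so v′ has positive weighted degree and vv′ is separated as well.

open import Defs
open import Data.Fin using (Fin)
open import Relation.Nullary using (¬_)
open import Relation.Binary.PropositionalEquality using (_≡_)

open import Algebra.Bundles using (CommutativeRing)
open import Data.Bool using (Bool; true; false; not; _∧_; _∨_; _xor_; T)
open import Data.Bool.Properties
  using (∧-assoc; ∧-comm; ∧-zeroʳ; ∧-identityʳ; ∨-zeroʳ; ∧-distribˡ-xor; xor-assoc; xor-comm;
         xor-same; xor-identityʳ; xor-inverseʳ; not-distribˡ-xor; T-≡; T-∧; xor-∧-commutativeRing)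
open import Algebra.Properties.CommutativeSemigroup
  (CommutativeRing.+-commutativeSemigroup xor-∧-commutativeRing) using (interchange)
open import Algebra.Properties.Group (CommutativeRing.+-group xor-∧-commutativeRing)
  using (∙-cancelʳ)
open import Data.Fin using (zero; suc; _≟_)
open import Data.Nat using (ℕ; zero; suc; _+_; _≤_; _<_; z≤n; s≤s)
open import Data.Nat.Properties using (≤-refl; ≤-trans; +-mono-≤; m≤m+n; m≤n+m; +-comm; 1+n≰n)
open import Data.Product using (Σ; _×_; _,_; proj₁; proj₂)
open import Function using (_∘_; id)
open import Function.Bundles using (Equivalence; mk⇔)
open import Relation.Binary.Construct.Closure.ReflexiveTransitive using (Star; ε; _◅_; map)
open import Relation.Binary.PropositionalEquality as ≡
  using (refl; trans; cong; cong₂; subst; subst₂; _≢_; module ≡-Reasoning)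
open import Relation.Nullary using (yes; no; does; ⌊_⌋; contradiction)
open import Relation.Nullary.Decidable using (dec-true; dec-false; does-⇔; isYes≗does)

open ≡-Reasoning

odd : ℕ → Bool
odd zero    = false
odd (suc k) = not (odd k)

odd-+ : ∀ m n → odd (m + n) ≡ odd m xor odd n
odd-+ zero    n = refl
odd-+ (suc m) n = trans (cong not (odd-+ m n)) (not-distribˡ-xor (odd m) (odd n))

odd-b2n : ∀ b → odd (b2n b) ≡ b
odd-b2n true  = refl
odd-b2n false = refl

even-≤1⇒≡0 : ∀ {k} → k ≤ 1 → odd k ≡ false → k ≡ 0
even-≤1⇒≡0 z≤n       _  = refl
even-≤1⇒≡0 (s≤s z≤n) ()

b2n-∧-≤ : ∀ a b → b2n (a ∧ b) ≤ b2n a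
b2n-∧-≤ true  true  = ≤-refl
b2n-∧-≤ true  false = z≤n
b2n-∧-≤ false b     = z≤n

xor-telescope : ∀ p a b c → (p xor (a xor b)) xor (b xor c) ≡ p xor (a xor c)
xor-telescope p a b c = begin
  (p xor (a xor b)) xor (b xor c)  ≡⟨ xor-assoc p _ _ ⟩
  p xor ((a xor b) xor (b xor c))  ≡⟨ cong (p xor_) (xor-assoc a b _) ⟩
  p xor (a xor (b xor (b xor c)))  ≡⟨ cong (λ t → p xor (a xor t)) (≡.sym (xor-assoc b b c)) ⟩
  p xor (a xor ((b xor b) xor c))  ≡⟨ cong (λ t → p xor (a xor (t xor c))) (xor-same b) ⟩
  p xor (a xor c)                  ∎

infix 7 _≡ᵇ_

_≡ᵇ_ : ∀ {m} → Fin m → Fin m → Bool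
x ≡ᵇ y = does (x ≟ y)

≡ᵇ-sym : ∀ {m} (x y : Fin m) → x ≡ᵇ y ≡ y ≡ᵇ x
≡ᵇ-sym x y = does-⇔ (mk⇔ ≡.sym ≡.sym) (x ≟ y) (y ≟ x)

≡ᵇ-∧-≡ᵇ-false : ∀ {m} {p q r s : Fin m} → ¬ (p ≡ q × r ≡ s) → p ≡ᵇ q ∧ r ≡ᵇ s ≡ false
≡ᵇ-∧-≡ᵇ-false {p = p} {q} {r} {s} ¬eq with p ≟ q | r ≟ s
... | yes p≡q | yes r≡s = contradiction (p≡q , r≡s) ¬eq
... | yes _   | no _    = refl
... | no _    | _       = refl

∈₂-fst : ∀ {m} (x y : Fin m) → x ∈₂ (x , y) ≡ true
∈₂-fst x y = cong (_∨ ⌊ x ≟ y ⌋) (trans (isYes≗does (x ≟ x)) (dec-true (x ≟ x) refl))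

∈₂-snd : ∀ {m} (x y : Fin m) → y ∈₂ (x , y) ≡ true
∈₂-snd x y = trans (cong (⌊ y ≟ x ⌋ ∨_) (trans (isYes≗does (y ≟ y)) (dec-true (y ≟ y) refl)))
                   (∨-zeroʳ _)

sumFin-mono : ∀ m {f g : Fin m → ℕ} → (∀ i → f i ≤ g i) → sumFin m f ≤ sumFin m g
sumFin-mono zero    f≤g = z≤n
sumFin-mono (suc m) f≤g = +-mono-≤ (f≤g zero) (sumFin-mono m (f≤g ∘ suc))

sumFin-≥-term : ∀ m (f : Fin m → ℕ) i → f i ≤ sumFin m f
sumFin-≥-term (suc m) f zero    = m≤m+n (f zero) _
sumFin-≥-term (suc m) f (suc i) = ≤-trans (sumFin-≥-term m (f ∘ suc) i) (m≤n+m _ (f zero))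

sumFin-≥-pair : ∀ m (f : Fin m → ℕ) {i j} → i ≢ j → f i + f j ≤ sumFin m f
sumFin-≥-pair (suc m) f {zero}  {zero}  i≢j = contradiction refl i≢j
sumFin-≥-pair (suc m) f {zero}  {suc j} _   = +-mono-≤ ≤-refl (sumFin-≥-term m (f ∘ suc) j)
sumFin-≥-pair (suc m) f {suc i} {zero}  _   =
  subst (_≤ sumFin (suc m) f) (+-comm (f zero) (f (suc i)))
    (+-mono-≤ ≤-refl (sumFin-≥-term m (f ∘ suc) i))
sumFin-≥-pair (suc m) f {suc i} {suc j} i≢j =
  ≤-trans (sumFin-≥-pair m (f ∘ suc) (i≢j ∘ cong suc)) (m≤n+m _ (f zero))

xorFin : (m : ℕ) → (Fin m → Bool) → Bool
xorFin zero    f = false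
xorFin (suc m) f = f zero xor xorFin m (f ∘ suc)

odd-sumFin : ∀ m (f : Fin m → Bool) → odd (sumFin m (b2n ∘ f)) ≡ xorFin m f
odd-sumFin zero    f = refl
odd-sumFin (suc m) f =
  trans (odd-+ (b2n (f zero)) _) (cong₂ _xor_ (odd-b2n (f zero)) (odd-sumFin m (f ∘ suc)))

xorFin-cong : ∀ m {f g : Fin m → Bool} → (∀ i → f i ≡ g i) → xorFin m f ≡ xorFin m g
xorFin-cong zero    f≡g = refl
xorFin-cong (suc m) f≡g = cong₂ _xor_ (f≡g zero) (xorFin-cong m (f≡g ∘ suc))

xorFin-false : ∀ m → xorFin m (λ _ → false) ≡ false
xorFin-false zero    = refl
xorFin-false (suc m) = xorFin-false m

xorFin-xor : ∀ m (f g : Fin m → Bool) →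
             xorFin m (λ i → f i xor g i) ≡ xorFin m f xor xorFin m g
xorFin-xor zero    f g = refl
xorFin-xor (suc m) f g =
  trans (cong ((f zero xor g zero) xor_) (xorFin-xor m (f ∘ suc) (g ∘ suc)))
        (interchange (f zero) (g zero) _ _)

xorFin-select : ∀ m (f : Fin m → Bool) z → xorFin m (λ i → f i ∧ i ≡ᵇ z) ≡ f z
xorFin-select (suc m) f zero =
  trans (cong₂ _xor_ (∧-identityʳ (f zero))
                     (trans (xorFin-cong m (∧-zeroʳ ∘ f ∘ suc)) (xorFin-false m)))
        (xor-identityʳ (f zero))
xorFin-select (suc m) f (suc z) =
  trans (cong (_xor xorFin m (λ i → f (suc i) ∧ i ≡ᵇ z)) (∧-zeroʳ (f zero)))
        (xorFin-select m (f ∘ suc) z)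

Adj-sym : (G : Graph) → ∀ {x y} → Adj G x y → Adj G y x
Adj-sym G {x} {y} = subst T (Graph.sym G x y)

Adj-irrefl : (G : Graph) → ∀ {x y} → Adj G x y → x ≢ y
Adj-irrefl G {x} xy refl = subst T (irrefl G x) xy

bipartite-colouring-at : (G : Graph) → Bipartite G → ∀ v →
  Σ (Fin (n G) → Bool) λ c → (∀ x y → Adj G x y → c x ≢ c y) × c v ≡ true
bipartite-colouring-at G (c , c-proper) v =
  (λ x → c x xor not (c v)) ,
  (λ x y xy → c-proper x y xy ∘ ∙-cancelʳ (not (c v)) (c x) (c y)) ,
  xor-inverseʳ (c v)

module _ (G : Graph) where

  private
    N : ℕ
    N = n G

    V : Set
    V = Fin N

  edgeIndicator : V → V → V → V → Bool
  edgeIndicator a b x y = (x ≡ᵇ a ∧ y ≡ᵇ b) xor (x ≡ᵇ b ∧ y ≡ᵇ a)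

  edgeIndicator-sym : ∀ a b x y → edgeIndicator a b x y ≡ edgeIndicator a b y x
  edgeIndicator-sym a b x y =
    trans (xor-comm (x ≡ᵇ a ∧ y ≡ᵇ b) (x ≡ᵇ b ∧ y ≡ᵇ a))
          (cong₂ _xor_ (∧-comm (x ≡ᵇ b) (y ≡ᵇ a)) (∧-comm (x ≡ᵇ a) (y ≡ᵇ b)))

  toggle : V → V → EdgeWeight G → EdgeWeight G
  toggle a b (w , w-sym) =
    (λ x y → w x y xor edgeIndicator a b x y) ,
    (λ x y → cong₂ _xor_ (w-sym x y) (edgeIndicator-sym a b x y))

  ShiftsParity : (EdgeWeight G → EdgeWeight G) → (V → Bool) → Set
  ShiftsParity t δ = ∀ ω x → odd (wdeg G (t ω) x) ≡ odd (wdeg G ω x) xor δ x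

  odd-wdeg : ∀ ω x → odd (wdeg G ω x) ≡ xorFin N (λ y → adj G x y ∧ proj₁ ω x y)
  odd-wdeg ω x = odd-sumFin N _

  adj-∧-≡ᵇ : ∀ {a b} → Adj G a b → ∀ x → adj G x b ∧ x ≡ᵇ a ≡ x ≡ᵇ a
  adj-∧-≡ᵇ {a} ab x with x ≟ a
  ... | yes refl = trans (∧-identityʳ _) (Equivalence.to T-≡ ab)
  ... | no _     = ∧-zeroʳ _

  xorFin-edgeIndicator : ∀ {a b} → Adj G a b → ∀ x →
    xorFin N (λ y → adj G x y ∧ edgeIndicator a b x y) ≡ x ≡ᵇ a xor x ≡ᵇ b
  xorFin-edgeIndicator {a} {b} ab x = begin
    xorFin N (λ y → adj G x y ∧ edgeIndicator a b x y)
      ≡⟨ xorFin-cong N distrib ⟩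
    xorFin N (λ y → (edgeFrom a y ∧ y ≡ᵇ b) xor (edgeFrom b y ∧ y ≡ᵇ a))
      ≡⟨ xorFin-xor N (λ y → edgeFrom a y ∧ y ≡ᵇ b) (λ y → edgeFrom b y ∧ y ≡ᵇ a) ⟩
    xorFin N (λ y → edgeFrom a y ∧ y ≡ᵇ b) xor xorFin N (λ y → edgeFrom b y ∧ y ≡ᵇ a)
      ≡⟨ cong₂ _xor_ (xorFin-select N (edgeFrom a) b) (xorFin-select N (edgeFrom b) a) ⟩
    edgeFrom a b xor edgeFrom b a
      ≡⟨ cong₂ _xor_ (adj-∧-≡ᵇ ab x) (adj-∧-≡ᵇ (Adj-sym G ab) x) ⟩
    x ≡ᵇ a xor x ≡ᵇ b
      ∎
    where
    edgeFrom : V → V → Bool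
    edgeFrom c y = adj G x y ∧ x ≡ᵇ c

    distrib : ∀ y → adj G x y ∧ edgeIndicator a b x y
                  ≡ (edgeFrom a y ∧ y ≡ᵇ b) xor (edgeFrom b y ∧ y ≡ᵇ a)
    distrib y = trans (∧-distribˡ-xor (adj G x y) (x ≡ᵇ a ∧ y ≡ᵇ b) (x ≡ᵇ b ∧ y ≡ᵇ a))
                      (cong₂ _xor_ (≡.sym (∧-assoc (adj G x y) (x ≡ᵇ a) (y ≡ᵇ b)))
                                   (≡.sym (∧-assoc (adj G x y) (x ≡ᵇ b) (y ≡ᵇ a))))

  toggle-shifts : ∀ {a b} → Adj G a b → ShiftsParity (toggle a b) (λ x → x ≡ᵇ a xor x ≡ᵇ b)
  toggle-shifts {a} {b} ab ω x = begin
    odd (wdeg G (toggle a b ω) x)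
      ≡⟨ odd-wdeg (toggle a b ω) x ⟩
    xorFin N (λ y → adj G x y ∧ (w x y xor edgeIndicator a b x y))
      ≡⟨ xorFin-cong N (λ y → ∧-distribˡ-xor (adj G x y) _ _) ⟩
    xorFin N (λ y → (adj G x y ∧ w x y) xor (adj G x y ∧ edgeIndicator a b x y))
      ≡⟨ xorFin-xor N _ _ ⟩
    xorFin N (λ y → adj G x y ∧ w x y) xor xorFin N (λ y → adj G x y ∧ edgeIndicator a b x y)
      ≡⟨ cong₂ _xor_ (≡.sym (odd-wdeg ω x)) (xorFin-edgeIndicator ab x) ⟩
    odd (wdeg G ω x) xor (x ≡ᵇ a xor x ≡ᵇ b)
      ∎
    where
    w : V → V → Bool
    w = proj₁ ω

  toggleWalk : ∀ {a b} → Star (Adj G) a b → EdgeWeight G → EdgeWeight G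
  toggleWalk ε                    = id
  toggleWalk (_◅_ {i} {j} _ p) ω = toggleWalk p (toggle i j ω)

  toggleWalk-shifts : ∀ {a b} (p : Star (Adj G) a b) →
                      ShiftsParity (toggleWalk p) (λ x → x ≡ᵇ a xor x ≡ᵇ b)
  toggleWalk-shifts {a} ε ω x =
    ≡.sym (trans (cong (odd (wdeg G ω x) xor_) (xor-same (x ≡ᵇ a))) (xor-identityʳ _))
  toggleWalk-shifts {a} {b} (_◅_ {j = j} aj p) ω x = begin
    odd (wdeg G (toggleWalk p (toggle a j ω)) x)
      ≡⟨ toggleWalk-shifts p (toggle a j ω) x ⟩
    odd (wdeg G (toggle a j ω) x) xor (x ≡ᵇ j xor x ≡ᵇ b)
      ≡⟨ cong (_xor (x ≡ᵇ j xor x ≡ᵇ b)) (toggle-shifts aj ω x) ⟩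
    (odd (wdeg G ω x) xor (x ≡ᵇ a xor x ≡ᵇ j)) xor (x ≡ᵇ j xor x ≡ᵇ b)
      ≡⟨ xor-telescope (odd (wdeg G ω x)) (x ≡ᵇ a) (x ≡ᵇ j) (x ≡ᵇ b) ⟩
    odd (wdeg G ω x) xor (x ≡ᵇ a xor x ≡ᵇ b)
      ∎

  toggleWalkIf : Bool → ∀ {a b} → Star (Adj G) a b → EdgeWeight G → EdgeWeight G
  toggleWalkIf true  p = toggleWalk p
  toggleWalkIf false p = id

  toggleWalkIf-shifts : ∀ c {a b} (p : Star (Adj G) a b) →
    ShiftsParity (toggleWalkIf c p) (λ x → c ∧ (x ≡ᵇ a xor x ≡ᵇ b))
  toggleWalkIf-shifts true  p = toggleWalk-shifts p
  toggleWalkIf-shifts false p ω x = ≡.sym (xor-identityʳ _)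

  applyAll : ∀ m → (Fin m → EdgeWeight G → EdgeWeight G) → EdgeWeight G → EdgeWeight G
  applyAll zero    t = id
  applyAll (suc m) t = applyAll m (t ∘ suc) ∘ t zero

  applyAll-shifts : ∀ m {t : Fin m → EdgeWeight G → EdgeWeight G} {δ : Fin m → V → Bool} →
    (∀ i → ShiftsParity (t i) (δ i)) → ShiftsParity (applyAll m t) (λ x → xorFin m (λ i → δ i x))
  applyAll-shifts zero    t-shifts ω x = ≡.sym (xor-identityʳ _)
  applyAll-shifts (suc m) {t} {δ} t-shifts ω x = begin
    odd (wdeg G (applyAll m (t ∘ suc) (t zero ω)) x)
      ≡⟨ applyAll-shifts m (t-shifts ∘ suc) (t zero ω) x ⟩
    odd (wdeg G (t zero ω) x) xor xorFin m (λ i → δ (suc i) x)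
      ≡⟨ cong (_xor xorFin m (λ i → δ (suc i) x)) (t-shifts zero ω x) ⟩
    (odd (wdeg G ω x) xor δ zero x) xor xorFin m (λ i → δ (suc i) x)
      ≡⟨ xor-assoc (odd (wdeg G ω x)) (δ zero x) _ ⟩
    odd (wdeg G ω x) xor xorFin (suc m) (λ i → δ i x)
      ∎

  zeroWeight : EdgeWeight G
  zeroWeight = (λ _ _ → false) , (λ _ _ → refl)

  odd-wdeg-zeroWeight : ∀ x → odd (wdeg G zeroWeight x) ≡ false
  odd-wdeg-zeroWeight x =
    trans (odd-wdeg zeroWeight x) (trans (xorFin-cong N (∧-zeroʳ ∘ adj G x)) (xorFin-false N))

  -- Toggle a walk from r to each y with f y; a vertex x ≢ r is an end of exactly one of them iff f x.
  parities-realizable : Connected G → ∀ r (f : V → Bool) →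
    Σ (EdgeWeight G) λ ω → ∀ x → x ≢ r → odd (wdeg G ω x) ≡ f x
  parities-realizable conn r f = applyAll N t zeroWeight , realizes
    where
    t : V → EdgeWeight G → EdgeWeight G
    t y = toggleWalkIf (f y) (conn r y)

    realizes : ∀ x → x ≢ r → odd (wdeg G (applyAll N t zeroWeight) x) ≡ f x
    realizes x x≢r = begin
      odd (wdeg G (applyAll N t zeroWeight) x)
        ≡⟨ applyAll-shifts N (λ y → toggleWalkIf-shifts (f y) (conn r y)) zeroWeight x ⟩
      odd (wdeg G zeroWeight x) xor xorFin N (λ y → f y ∧ (x ≡ᵇ r xor x ≡ᵇ y))
        ≡⟨ cong₂ _xor_ (odd-wdeg-zeroWeight x) (xorFin-cong N off-root) ⟩
      xorFin N (λ y → f y ∧ y ≡ᵇ x)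
        ≡⟨ xorFin-select N f x ⟩
      f x
        ∎
      where
      off-root : ∀ y → f y ∧ (x ≡ᵇ r xor x ≡ᵇ y) ≡ f y ∧ y ≡ᵇ x
      off-root y = cong (f y ∧_) (trans (cong (_xor (x ≡ᵇ y)) (dec-false (x ≟ r) x≢r)) (≡ᵇ-sym x y))

  deleteEdge-⊆ : ∀ {a b x y} → Adj (deleteEdge G a b) x y → Adj G x y
  deleteEdge-⊆ = proj₁ ∘ Equivalence.to T-∧

  deleteEdge-deletes : ∀ a b → ¬ Adj (deleteEdge G a b) a b
  deleteEdge-deletes a b ab =
    proj₂ (Equivalence.to T-∧ (subst (λ q → T (adj G a b ∧ not q))
                                      (cong₂ _∧_ (∈₂-fst a b) (∈₂-snd a b)) ab))

  toggle-elsewhere : ∀ {a b x y} → Adj (deleteEdge G a b) x y → ∀ ω →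
                     proj₁ (toggle x y ω) a b ≡ proj₁ ω a b
  toggle-elsewhere {a} {b} {x} {y} xy ω =
    trans (cong (proj₁ ω a b xor_) (cong₂ _xor_ (≡ᵇ-∧-≡ᵇ-false same) (≡ᵇ-∧-≡ᵇ-false swapped)))
          (xor-identityʳ _)
    where
    same : ¬ (a ≡ x × b ≡ y)
    same (refl , refl) = deleteEdge-deletes a b xy
    swapped : ¬ (a ≡ y × b ≡ x)
    swapped (refl , refl) = deleteEdge-deletes a b (Adj-sym (deleteEdge G a b) xy)

  toggleWalk-avoiding : ∀ {a b x y} (p : Star (Adj (deleteEdge G a b)) x y) ω →
                        proj₁ (toggleWalk (map deleteEdge-⊆ p) ω) a b ≡ proj₁ ω a b
  toggleWalk-avoiding ε        ω = refl
  toggleWalk-avoiding (xy ◅ p) ω = trans (toggleWalk-avoiding p _) (toggle-elsewhere xy ω)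

  toggleCycle : ∀ {a b} → Adj G a b → Star (Adj (deleteEdge G a b)) b a →
                EdgeWeight G → EdgeWeight G
  toggleCycle ab p = toggleWalk (ab ◅ map deleteEdge-⊆ p)

  toggleCycle-shifts : ∀ {a b} (ab : Adj G a b) p → ShiftsParity (toggleCycle ab p) (λ _ → false)
  toggleCycle-shifts {a} ab p ω x =
    trans (toggleWalk-shifts (ab ◅ map deleteEdge-⊆ p) ω x)
          (cong (odd (wdeg G ω x) xor_) (xor-same (x ≡ᵇ a)))

  toggleCycle-flips : ∀ {a b} (ab : Adj G a b) p ω →
                      proj₁ (toggleCycle ab p ω) a b ≡ not (proj₁ ω a b)
  toggleCycle-flips {a} {b} ab p ω =
    trans (toggleWalk-avoiding p (toggle a b ω))
          (trans (cong (proj₁ ω a b xor_) toggled) (xor-comm _ true))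
    where
    toggled : edgeIndicator a b a b ≡ true
    toggled = cong₂ _xor_ (cong₂ _∧_ (dec-true (a ≟ a) refl) (dec-true (b ≟ b) refl))
                          (cong (_∧ (b ≡ᵇ a)) (dec-false (a ≟ b) (Adj-irrefl G ab)))

  wdeg≤degree : ∀ ω x → wdeg G ω x ≤ degree G x
  wdeg≤degree ω x = sumFin-mono N (λ y → b2n-∧-≤ (adj G x y) (proj₁ ω x y))

  wdeg-positive : ∀ {x y} → Adj G x y → ∀ ω → proj₁ ω x y ≡ true → 0 < wdeg G ω x
  wdeg-positive {x} {y} xy ω wxy =
    subst (_≤ wdeg G ω x) (cong₂ (λ p q → b2n (p ∧ q)) (Equivalence.to T-≡ xy) wxy)
          (sumFin-≥-term N _ y)

  degree-one⇒neighbour-unique : ∀ {v y y′} → degree G v ≡ 1 → Adj G v y → Adj G v y′ → y ≡ y′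
  degree-one⇒neighbour-unique {v} {y} {y′} deg1 vy vy′ with y ≟ y′
  ... | yes y≡y′ = y≡y′
  ... | no y≢y′  = contradiction two≤one 1+n≰n
    where
    two≤one : 2 ≤ 1
    two≤one = subst₂ (λ p q → b2n p + b2n q ≤ 1) (Equivalence.to T-≡ vy) (Equivalence.to T-≡ vy′)
                     (subst (b2n (adj G v y) + b2n (adj G v y′) ≤_) deg1
                            (sumFin-≥-pair N (λ z → b2n (adj G v z)) y≢y′))

  module _ (c : V → Bool) (c-proper : ∀ x y → Adj G x y → c x ≢ c y) where

    has01-of-parity-colouring : (ω : EdgeWeight G) → (∀ x → odd (wdeg G ω x) ≡ c x) →
                                Has01Property G
    has01-of-parity-colouring ω odd≡c = ω , λ x y xy eq →
      c-proper x y xy (trans (≡.sym (odd≡c x)) (trans (cong odd eq) (odd≡c y)))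

    has01-of-even-pendant : ∀ {v v′} → degree G v ≡ 1 → Adj G v v′ → (ω : EdgeWeight G) →
      (∀ x → x ≢ v → odd (wdeg G ω x) ≡ c x) → odd (wdeg G ω v) ≡ false →
      0 < wdeg G ω v′ → Has01Property G
    has01-of-even-pendant {v} {v′} deg1 vv′ ω odd≡c even-v positive-v′ = ω , separated
      where
      wdeg-v≡0 : wdeg G ω v ≡ 0
      wdeg-v≡0 = even-≤1⇒≡0 (subst (wdeg G ω v ≤_) deg1 (wdeg≤degree ω v)) even-v

      v-v′-separated : wdeg G ω v ≢ wdeg G ω v′
      v-v′-separated eq = contradiction (subst (0 <_) (trans (≡.sym eq) wdeg-v≡0) positive-v′) λ ()

      separated : ∀ x y → Adj G x y → wdeg G ω x ≢ wdeg G ω y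
      separated x y xy with x ≟ v | y ≟ v
      ... | yes refl | _ with degree-one⇒neighbour-unique deg1 xy vv′
      ...   | refl = v-v′-separated
      separated x y xy | no _ | yes refl with degree-one⇒neighbour-unique deg1 (Adj-sym G xy) vv′
      ...   | refl = v-v′-separated ∘ ≡.sym
      separated x y xy | no x≢v | no y≢v = λ eq →
        c-proper x y xy (trans (≡.sym (odd≡c x x≢v)) (trans (cong odd eq) (odd≡c y y≢v)))

    has01-of-even-pendant-on-cycle : ∀ {v v′ u} → degree G v ≡ 1 → Adj G v v′ →
      (v′u : Adj G v′ u) → Star (Adj (deleteEdge G v′ u)) u v′ → (ω : EdgeWeight G) →
      (∀ x → x ≢ v → odd (wdeg G ω x) ≡ c x) → odd (wdeg G ω v) ≡ false → Has01Property G
    has01-of-even-pendant-on-cycle {v} {v′} {u} deg1 vv′ v′u p ω odd≡c even-v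
      with proj₁ ω v′ u in w-v′u
    ... | true  = has01-of-even-pendant deg1 vv′ ω odd≡c even-v (wdeg-positive v′u ω w-v′u)
    ... | false = has01-of-even-pendant deg1 vv′ ω′
                    (λ x x≢v → trans (same-parity x) (odd≡c x x≢v))
                    (trans (same-parity v) even-v)
                    (wdeg-positive v′u ω′ (trans (toggleCycle-flips v′u p ω) (cong not w-v′u)))
      where
      ω′ : EdgeWeight G
      ω′ = toggleCycle v′u p ω

      same-parity : ∀ x → odd (wdeg G ω′ x) ≡ odd (wdeg G ω x)
      same-parity x = trans (toggleCycle-shifts v′u p ω x) (xor-identityʳ _)

lemma11 : (G : Graph) → Connected G → Bipartite G → ¬ Has01Property G →
          (v v' : Fin (n G)) → degree G v ≡ 1 → Adj G v v' →
          ∀ u → Adj G v' u → IsBridge G v' u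
lemma11 G conn bip ¬has01 v v′ deg1 vv′ u v′u with bipartite-colouring-at G bip v
... | c , c-proper , c-v with parities-realizable G conn v c
...   | ω , odd≡c = v′u , ¬has01 ∘ has01
  where
  has01 : Connected (deleteEdge G v′ u) → Has01Property G
  has01 conn′ with odd (wdeg G ω v) in odd-v
  ... | true  = has01-of-parity-colouring G c c-proper ω odd≡c-everywhere
    where
    odd≡c-everywhere : ∀ x → odd (wdeg G ω x) ≡ c x
    odd≡c-everywhere x with x ≟ v
    ... | yes refl = trans odd-v (≡.sym c-v)
    ... | no x≢v   = odd≡c x x≢v
  ... | false = has01-of-even-pendant-on-cycle G c c-proper deg1 vv′ v′u (conn′ u v′) ω odd≡c odd-v
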